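{- Let $q$ be a power of an odd prime, let $d\ge 2$ and $k\geq 1$ be integers, let $r\in \mathbb{F}_q$ be a nonzero square (i.e. $r=a^2$ for some $a\in\mathbb{F}_q$, $r\neq 0$), and let $A$ be a nonempty subset of $\{(i,j):1\leq i<j\leq k+1\}$. If $E\subset \mathbb{F}_q^d$ satisfies $\lvert E\rvert\geq 2kq^{d/2}$, then there exist $(x_1,\dots,x_{k+1})\in E^{k+1}$ and $(y_1,\dots,y_{k+1})\in E^{k+1}$ such that $\lVert y_i-y_j \rVert=r\lVert x_i-x_j \rVert$ for all $(i,j)\in A$, and $x_i\neq x_j$, $y_i\neq y_j$ for all $1\leq i<j\leq k+1$.
   Context: $\mathbb{F}_q$ denotes the finite field with $q$ elements and $\mathbb{F}_q^d$ the $d$-dimensional vector space over it. For $\alpha=(\alpha_1,\dots,\alpha_d)\in\mathbb{F}_q^d$, $\lVert \alpha\rVert:=\alpha_1^2+\dots+\alpha_d^2\in\mathbb{F}_q$. -}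

module Defs where

open import Level using (0ℓ)
open import Data.Nat using (ℕ; zero; suc; _^_; _≥_)
open import Data.Nat.Primality using (Prime)
open import Data.Fin using (Fin)
open import Data.Product using (∃; ∃-syntax; _×_)
open import Function using (_∘_)
open import Function.Bundles using (_↔_)
open import Relation.Nullary using (¬_)
open import Relation.Binary.PropositionalEquality using (_≡_; _≢_)
open import Algebra.Structures using (IsCommutativeRing)

OddPrimePower : ℕ → Set
OddPrimePower q = ∃[ p ] ∃[ n ] (Prime p × ¬ (p ≡ 2) × n ≥ 1 × q ≡ p ^ n)

record FiniteField (q : ℕ) : Set₁ where
  infixl 6 _+_
  infixl 7 _*_
  field
    Carrier : Set
    _+_ _*_ : Carrier → Carrier → Carrier
    -_      : Carrier → Carrier
    0# 1#   : Carrier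
    isCommutativeRing : IsCommutativeRing _≡_ _+_ _*_ -_ 0# 1#
    0≢1     : 0# ≢ 1#
    inv     : (x : Carrier) → x ≢ 0# → Carrier
    inv-law : (x : Carrier) (x≢0 : x ≢ 0#) → x * inv x x≢0 ≡ 1#
    enumeration : Fin q ↔ Carrier

  _-_ : Carrier → Carrier → Carrier
  x - y = x + (- y)

  Vect : ℕ → Set
  Vect d = Fin d → Carrier

  sumF : ∀ {n} → (Fin n → Carrier) → Carrier
  sumF {zero}  f = 0#
  sumF {suc n} f = f Fin.zero + sumF (f ∘ Fin.suc)

  _-ᵥ_ : ∀ {d} → Vect d → Vect d → Vect d
  (x -ᵥ y) i = x i - y i

  ‖_‖ : ∀ {d} → Vect d → Carrier
  ‖ α ‖ = sumF (λ i → α i * α i)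

  IsNonzeroSquare : Carrier → Set
  IsNonzeroSquare r = (r ≢ 0#) × (∃[ a ] r ≡ a * a)

-- Compare pairs (x , y) ∈ E² through their offset y - a·x: pairs with a common offset z are related
-- by the homothety v ↦ a·v + z, which multiplies every ‖ x_i - x_j ‖ by a² = r.  Once |E|² > k·q^d,
-- the pigeonhole principle gives k + 1 pairs with a common offset, and as a ≠ 0 their first
-- components are pairwise distinct exactly when their second components are.
-- Points are functions Fin d → F_q, so E may contain distinct but pointwise equal entries.  Give
-- each position of E its occurrence index, the number of earlier entries pointwise equal to it.  If
-- some index reaches k, then k + 1 copies of one point form a degenerate solution with y = x.
-- Otherwise every index is below k, and adding the difference of the two indices (a number in
-- [0 , 2k)) to the pigeonhole label separates equal points inside a fiber; the size assumption
-- pays for this, since 2k²·q^d < |E|².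
module Submission where

open import Data.Nat using (ℕ)
open import Data.List using (List)
open import Data.List.Relation.Unary.Unique.Propositional using (Unique)
open import Defs using (FiniteField)

module Counting where
  open import Level using (0ℓ)
  open import Data.Nat
    using (ℕ; zero; suc; _+_; _*_; _^_; _≤_; _<_; _≤′_; ≤′-refl; ≤′-step; _<?_; s≤s; s≤s⁻¹)
  open import Data.Nat.Properties
  open import Data.Fin using (Fin; toℕ)
  open import Data.Fin.Properties using (toℕ<n; toℕ-injective)
  open import Data.Product using (∃-syntax; _×_; _,_; map₁)
  open import Data.List using (List; []; _∷_; length; filter; downFrom; cartesianProduct; map)
  open import Data.List.Properties using (length-++; length-map)
  import Data.List.Relation.Unary.All as All
  open import Data.List.Relation.Unary.AllPairs using (_∷_)
  open import Data.List.Relation.Unary.Any using (here; there)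
  open import Data.List.Relation.Unary.Unique.Propositional using (Unique)
  open import Data.List.Membership.Propositional using (_∈_)
  open import Data.List.Membership.Propositional.Properties using (∈-filter⁻; ∈-downFrom⁻)
  open import Data.List.Relation.Unary.Unique.Propositional.Properties using (filter⁺; downFrom⁺)
  open import Data.List.Relation.Binary.Sublist.Propositional.Properties
    using (filter-⊆; length-mono-≤) renaming (filter⁺ to filter⁺-⊆)
  open import Function using (_∘_)
  open import Function.Definitions using (Injective)
  open import Relation.Binary.Definitions using (DecidableEquality; tri<; tri≈; tri>)
  open import Relation.Binary.PropositionalEquality
  open import Relation.Nullary using (¬?; yes; no; contradiction)
  open import Relation.Unary using (Pred; Decidable)
  open import Data.Nat.Tactic.RingSolver using (solve)

  module _ {A : Set} {P : Pred A 0ℓ} (P? : Decidable P) where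

    length-filter-split : ∀ xs → length xs ≡ length (filter P? xs) + length (filter (¬? ∘ P?) xs)
    length-filter-split [] = refl
    length-filter-split (x ∷ xs) with P? x
    ... | yes _ = cong suc (length-filter-split xs)
    ... | no _ = trans (cong suc (length-filter-split xs)) (sym (+-suc _ _))

    length-filter-filter : {Q : Pred A 0ℓ} (Q? : Decidable Q) (xs : List A) →
      length (filter P? (filter Q? xs)) ≤ length (filter P? xs)
    length-filter-filter Q? xs = length-mono-≤ (filter⁺-⊆ P? P? (λ { refl p → p }) (filter-⊆ Q? xs))

  length-cartesianProduct : {A B : Set} (xs : List A) (ys : List B) →
    length (cartesianProduct xs ys) ≡ length xs * length ys
  length-cartesianProduct [] ys = refl
  length-cartesianProduct (x ∷ xs) ys =
    trans (length-++ (map (x ,_) ys)) (cong₂ _+_ (length-map _ ys) (length-cartesianProduct xs ys))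

  module _ {A B : Set} (_≟_ : DecidableEquality B) (f : A → B) where

    fiber : B → List A → List A
    fiber v = filter (λ x → f x ≟ v)

    ∈-fiber⁻ : ∀ {v xs x} → x ∈ fiber v xs → x ∈ xs × f x ≡ v
    ∈-fiber⁻ {v} = ∈-filter⁻ (λ x → f x ≟ v)

    fiber-unique : ∀ v {xs} → Unique xs → Unique (fiber v xs)
    fiber-unique v = filter⁺ (λ x → f x ≟ v)

    pigeonhole : ∀ m (vs : List B) (xs : List A) → (∀ {x} → x ∈ xs → f x ∈ vs) →
                 m * length vs < length xs → ∃[ v ] m < length (fiber v xs)
    pigeonhole m [] [] _ m*0<0 = contradiction m*0<0 n≮0
    pigeonhole m [] (x ∷ _) into _ with into (here refl)
    ... | ()
    pigeonhole m (v ∷ vs) xs into big with m <? length (fiber v xs)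
    ... | yes m<fiber = v , m<fiber
    ... | no m≮fiber =
      let w , m<fiber-rest = pigeonhole m vs rest rest-into rest-big
      in w , <-≤-trans m<fiber-rest (length-filter-filter _ (λ x → ¬? (f x ≟ v)) xs)
      where
      rest : List A
      rest = filter (λ x → ¬? (f x ≟ v)) xs

      rest-into : ∀ {x} → x ∈ rest → f x ∈ vs
      rest-into x∈rest with ∈-filter⁻ (λ x → ¬? (f x ≟ v)) x∈rest
      ... | x∈xs , fx≢v with into x∈xs
      ...   | here fx≡v = contradiction fx≡v fx≢v
      ...   | there fx∈vs = fx∈vs

      rest-big : m * length vs < length rest
      rest-big = +-cancelˡ-< m _ _ (begin-strict
        m + m * length vs                 ≡⟨ *-suc m (length vs) ⟨
        m * suc (length vs)               <⟨ big ⟩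
        length xs                         ≡⟨ length-filter-split (λ x → f x ≟ v) xs ⟩
        length (fiber v xs) + length rest ≤⟨ +-monoˡ-≤ (length rest) (≮⇒≥ m≮fiber) ⟩
        m + length rest                   ∎)
        where open ≤-Reasoning

  module _ {A : Set} (default : A) where

    at : List A → ℕ → A
    at [] _ = default
    at (x ∷ xs) zero = x
    at (x ∷ xs) (suc u) = at xs u

    at-∈ : ∀ xs {u} → u < length xs → at xs u ∈ xs
    at-∈ (x ∷ xs) {zero} _ = here refl
    at-∈ (x ∷ xs) {suc u} u<len = there (at-∈ xs (s≤s⁻¹ u<len))

    at-injective : ∀ xs → Unique xs → ∀ {u v} → u < length xs → v < length xs → at xs u ≡ at xs v → u ≡ v
    at-injective (x ∷ xs) _ {zero} {zero} _ _ _ = refl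
    at-injective (x ∷ xs) (x∉xs ∷ _) {zero} {suc v} _ v<len eq =
      contradiction eq (All.lookup x∉xs (at-∈ xs (s≤s⁻¹ v<len)))
    at-injective (x ∷ xs) (x∉xs ∷ _) {suc u} {zero} u<len _ eq =
      contradiction (sym eq) (All.lookup x∉xs (at-∈ xs (s≤s⁻¹ u<len)))
    at-injective (x ∷ xs) (_ ∷ unique) {suc u} {suc v} u<len v<len eq =
      cong suc (at-injective xs unique (s≤s⁻¹ u<len) (s≤s⁻¹ v<len) eq)

  record DistinctMembers {A : Set} (m : ℕ) (xs : List A) : Set where
    field
      pick : Fin (suc m) → A
      pick-∈ : ∀ i → pick i ∈ xs
      pick-injective : Injective _≡_ _≡_ pick

  distinct-members : {A : Set} (m : ℕ) (xs : List A) → Unique xs → m < length xs → DistinctMembers m xs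
  distinct-members m xs@(x ∷ _) unique m<len = record
    { pick = λ i → at x xs (toℕ i)
    ; pick-∈ = λ i → at-∈ x xs (index< i)
    ; pick-injective = λ eq → toℕ-injective (at-injective x xs unique (index< _) (index< _) eq)
    }
    where
    index< : ∀ i → toℕ i < length xs
    index< i = ≤-<-trans (s≤s⁻¹ (toℕ<n i)) m<len

  module Occurrences {B : Set} (_≟_ : DecidableEquality B) (c : ℕ → B) where

    positionsBelow : B → ℕ → List ℕ
    positionsBelow b p = filter (λ u → c u ≟ b) (downFrom p)

    positionsBelow-unique : ∀ b p → Unique (positionsBelow b p)
    positionsBelow-unique b p = filter⁺ (λ u → c u ≟ b) (downFrom⁺ p)

    ∈-positionsBelow⁻ : ∀ {b p u} → u ∈ positionsBelow b p → u < p × c u ≡ b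
    ∈-positionsBelow⁻ {b} u∈ = map₁ ∈-downFrom⁻ (∈-filter⁻ (λ u → c u ≟ b) u∈)

    occurrence : ℕ → ℕ
    occurrence p = length (positionsBelow (c p) p)

    length-positionsBelow-suc : ∀ {b u} → c u ≡ b →
      length (positionsBelow b (suc u)) ≡ suc (length (positionsBelow b u))
    length-positionsBelow-suc {b} {u} cu≡b with c u ≟ b
    ... | yes _ = refl
    ... | no cu≢b = contradiction cu≡b cu≢b

    length-positionsBelow-mono : ∀ b {u v} → u ≤′ v →
      length (positionsBelow b u) ≤ length (positionsBelow b v)
    length-positionsBelow-mono b ≤′-refl = ≤-refl
    length-positionsBelow-mono b (≤′-step {v} u≤′v) =
      ≤-trans (length-positionsBelow-mono b u≤′v) step
      where
      step : length (positionsBelow b v) ≤ length (positionsBelow b (suc v))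
      step with c v ≟ b
      ... | yes _ = n≤1+n _
      ... | no _ = ≤-refl

    occurrence-< : ∀ {u v} → u < v → c u ≡ c v → occurrence u < occurrence v
    occurrence-< {u} {v} u<v cu≡cv = begin-strict
      length (positionsBelow (c u) u)         ≡⟨ cong (λ b → length (positionsBelow b u)) cu≡cv ⟩
      length (positionsBelow (c v) u)         <⟨ n<1+n _ ⟩
      suc (length (positionsBelow (c v) u))   ≡⟨ length-positionsBelow-suc cu≡cv ⟨
      length (positionsBelow (c v) (suc u))   ≤⟨ length-positionsBelow-mono (c v) (≤⇒≤′ u<v) ⟩
      length (positionsBelow (c v) v)         ∎
      where open ≤-Reasoning

    occurrence-injective : ∀ {u v} → c u ≡ c v → occurrence u ≡ occurrence v → u ≡ v
    occurrence-injective {u} {v} cu≡cv occ≡ with <-cmp u v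
    ... | tri< u<v _ _ = contradiction occ≡ (<⇒≢ (occurrence-< u<v cu≡cv))
    ... | tri≈ _ u≡v _ = u≡v
    ... | tri> _ _ v<u = contradiction (sym occ≡) (<⇒≢ (occurrence-< v<u (sym cu≡cv)))

  square-bound : ∀ {k Q n} → 1 ≤ k → 1 ≤ Q → 4 * k ^ 2 * Q ≤ n ^ 2 → k * (Q * (k + k)) < n * n
  square-bound {k} {Q} {n} 1≤k 1≤Q big = begin-strict
    k * (Q * (k + k))                       <⟨ m<m+n _ positive ⟩
    k * (Q * (k + k)) + k * (Q * (k + k))   ≡⟨ solve (k ∷ Q ∷ []) ⟩
    4 * (k * k) * Q                         ≡⟨ cong (λ t → 4 * t * Q) (square k) ⟨
    4 * k ^ 2 * Q                           ≤⟨ big ⟩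
    n ^ 2                                   ≡⟨ square n ⟩
    n * n                                   ∎
    where
    open ≤-Reasoning
    square : ∀ m → m ^ 2 ≡ m * m
    square m = cong (m *_) (*-identityʳ m)
    positive : 0 < k * (Q * (k + k))
    positive = *-mono-≤ 1≤k (*-mono-≤ 1≤Q (≤-trans 1≤k (m≤m+n k k)))

module FieldFacts {q : ℕ} (Fq : FiniteField q) where
  import Data.Nat as ℕ
  open import Data.Nat using (z≤n; >-nonZero)
  open import Data.Nat.Properties using (≤-<-trans; m^n>0)
  open import Data.Fin using (Fin; combine)
  import Data.Fin.Properties as Fin
  open import Function using (_∘_; Injection)
  open import Function.Properties.Inverse using (↔-sym; ↔⇒↣)
  open import Relation.Binary.Definitions using (DecidableEquality)
  open import Relation.Binary.PropositionalEquality
  open import Algebra.Bundles using (CommutativeRing)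
  import Algebra.Solver.CommutativeMonoid as CommutativeMonoidSolver

  open FiniteField Fq

  commutativeRing : CommutativeRing _ _
  commutativeRing = record { isCommutativeRing = isCommutativeRing }

  open CommutativeRing commutativeRing
    using (+-identityˡ; -‿inverseʳ; distribˡ; zeroʳ; zeroˡ; *-assoc; *-comm; *-identityˡ;
           +-commutativeMonoid; *-commutativeSemigroup; ring)
  open import Algebra.Properties.Ring ring using (x[y-z]≈xy-xz; x∙y⁻¹≈ε⇒x≈y; //-rightDividesˡ)
  open import Algebra.Properties.CommutativeSemigroup *-commutativeSemigroup using (interchange)
  module +-Solver = CommutativeMonoidSolver +-commutativeMonoid

  index : Carrier → Fin q
  index = Injection.to (↔⇒↣ (↔-sym enumeration))

  index-injective : ∀ {x y} → index x ≡ index y → x ≡ y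
  index-injective = Injection.injective (↔⇒↣ (↔-sym enumeration))

  _≟_ : DecidableEquality Carrier
  _≟_ = Fin.inj⇒≟ (↔⇒↣ (↔-sym enumeration))

  q^d-positive : ∀ d → 0 ℕ.< q ℕ.^ d
  q^d-positive d = m^n>0 q {{>-nonZero (≤-<-trans z≤n (Fin.toℕ<n (index 0#)))}} d

  code : ∀ {d} → Vect d → Fin (q ℕ.^ d)
  code {ℕ.zero} v = Fin.zero
  code {ℕ.suc d} v = combine (index (v Fin.zero)) (code (v ∘ Fin.suc))

  code-injective : ∀ {d} {u v : Vect d} → code u ≡ code v → ∀ i → u i ≡ v i
  code-injective {ℕ.suc d} {u} {v} eq Fin.zero =
    index-injective (Fin.combine-injectiveˡ (index (u Fin.zero)) _ (index (v Fin.zero)) _ eq)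
  code-injective {ℕ.suc d} {u} {v} eq (Fin.suc i) =
    code-injective (Fin.combine-injectiveʳ (index (u Fin.zero)) _ (index (v Fin.zero)) _ eq) i

  code-cong : ∀ {d} {u v : Vect d} → (∀ i → u i ≡ v i) → code u ≡ code v
  code-cong {ℕ.zero} _ = refl
  code-cong {ℕ.suc d} u≗v = cong₂ combine (cong index (u≗v Fin.zero)) (code-cong (u≗v ∘ Fin.suc))

  offset : Carrier → Carrier → Carrier → Carrier
  offset a u v = u - (a * v)

  offset-≡⇒difference : ∀ a {u v u' v'} → offset a u v ≡ offset a u' v' → u - u' ≡ a * (v - v')
  offset-≡⇒difference a {u} {v} {u'} {v'} eq = begin
    u - u'                                ≡⟨ cong (_- u') (//-rightDividesˡ (a * v) u) ⟨
    ((u - (a * v)) + a * v) - u'          ≡⟨ cong (λ w → (w + a * v) - u') eq ⟩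
    ((u' - (a * v')) + a * v) - u'        ≡⟨ regroup u' (- (a * v')) (a * v) (- u') ⟩
    (u' - u') + ((a * v) - (a * v'))      ≡⟨ cong (_+ ((a * v) - (a * v'))) (-‿inverseʳ u') ⟩
    0# + ((a * v) - (a * v'))             ≡⟨ +-identityˡ _ ⟩
    (a * v) - (a * v')                    ≡⟨ x[y-z]≈xy-xz a v v' ⟨
    a * (v - v')                          ∎
    where
    open ≡-Reasoning
    regroup : ∀ w x y z → ((w + x) + y) + z ≡ (w + z) + (y + x)
    regroup = +-Solver.solve 4 (λ w x y z → ((w ⊕ x) ⊕ y) ⊕ z ⊜ (w ⊕ z) ⊕ (y ⊕ x)) refl
      where open +-Solver

  offset-injectiveˡ : ∀ a {u u' v} → offset a u v ≡ offset a u' v → u ≡ u'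
  offset-injectiveˡ a {u} {u'} {v} eq =
    x∙y⁻¹≈ε⇒x≈y u u' (trans (offset-≡⇒difference a eq) (trans (cong (a *_) (-‿inverseʳ v)) (zeroʳ a)))

  no-zero-divisors : ∀ {a w} → a ≢ 0# → a * w ≡ 0# → w ≡ 0#
  no-zero-divisors {a} {w} a≢0 aw≡0 = begin
    w                       ≡⟨ *-identityˡ w ⟨
    1# * w                  ≡⟨ cong (_* w) (trans (*-comm a⁻¹ a) (inv-law a a≢0)) ⟨
    (a⁻¹ * a) * w           ≡⟨ *-assoc a⁻¹ a w ⟩
    a⁻¹ * (a * w)           ≡⟨ cong (a⁻¹ *_) aw≡0 ⟩
    a⁻¹ * 0#                ≡⟨ zeroʳ a⁻¹ ⟩
    0#                      ∎
    where
    open ≡-Reasoning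
    a⁻¹ = inv a a≢0

  offset-injectiveʳ : ∀ {a u v v'} → a ≢ 0# → offset a u v ≡ offset a u v' → v ≡ v'
  offset-injectiveʳ {a} {u} a≢0 eq =
    x∙y⁻¹≈ε⇒x≈y _ _ (no-zero-divisors a≢0 (trans (sym (offset-≡⇒difference a eq)) (-‿inverseʳ u)))

  square≢0⇒≢0 : ∀ {a} → a * a ≢ 0# → a ≢ 0#
  square≢0⇒≢0 {a} a²≢0 a≡0 = a²≢0 (trans (cong (_* a) a≡0) (zeroˡ a))

  sumF-scale : ∀ {n} c (f g : Fin n → Carrier) → (∀ i → f i ≡ c * g i) → sumF f ≡ c * sumF g
  sumF-scale {ℕ.zero} c f g _ = sym (zeroʳ c)
  sumF-scale {ℕ.suc n} c f g f≗cg = begin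
    f Fin.zero + sumF (f ∘ Fin.suc)
      ≡⟨ cong₂ _+_ (f≗cg Fin.zero) (sumF-scale c _ _ (f≗cg ∘ Fin.suc)) ⟩
    c * g Fin.zero + c * sumF (g ∘ Fin.suc)
      ≡⟨ distribˡ c _ _ ⟨
    c * sumF g
      ∎
    where open ≡-Reasoning

  ‖‖-scale : ∀ {d} a (w z : Vect d) → (∀ i → w i ≡ a * z i) → ‖ w ‖ ≡ (a * a) * ‖ z ‖
  ‖‖-scale a w z w≗az = sumF-scale (a * a) _ _
    (λ i → trans (cong₂ _*_ (w≗az i) (w≗az i)) (interchange a (z i) a (z i)))

  ‖‖-homothety : ∀ {d} a {x x' y y' : Vect d} → (∀ i → offset a (y i) (x i) ≡ offset a (y' i) (x' i)) →
    ‖ y -ᵥ y' ‖ ≡ (a * a) * ‖ x -ᵥ x' ‖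
  ‖‖-homothety a eq = ‖‖-scale a _ _ (λ i → offset-≡⇒difference a (eq i))

module Homothety {q : ℕ} (Fq : FiniteField q) {d : ℕ} (E : List (FiniteField.Vect Fq d))
                 (E-unique : Unique E) (k : ℕ) (a : FiniteField.Carrier Fq) where
  open import Data.Nat using (suc; _+_; _*_; _∸_; _^_; _≤_; _<_; _≤?_; s≤s)
  open import Data.Nat.Properties
    using (≤-trans; <-≤-trans; ≤-<-trans; <⇒≤; m≤n+m; m∸n≤m; +-monoˡ-<; ≰⇒>; +-cancelʳ-≡; ∸-cancelʳ-≡;
           ∸-cancelˡ-≡; anyUpTo?)
  import Data.Nat as ℕ
  open import Data.Fin as Fin using (Fin)
  open import Data.Product using (∃-syntax; _×_; _,_; proj₁; proj₂; map)
  open import Data.Product.Properties using (≡-dec; ,-injective)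
  open import Data.List using (length; downFrom; cartesianProduct; allFin)
  open import Data.List.Properties using (length-downFrom; length-tabulate)
  open import Data.List.Membership.Propositional using (_∈_)
  open import Data.List.Membership.Propositional.Properties
    using (∈-downFrom⁺; ∈-downFrom⁻; ∈-allFin; ∈-cartesianProduct⁺; ∈-cartesianProduct⁻)
  open import Data.List.Relation.Unary.Unique.Propositional.Properties
    using (downFrom⁺; cartesianProduct⁺)
  open import Function using (_∘_; id)
  open import Function.Definitions using (Injective)
  open import Relation.Binary.PropositionalEquality
  open import Relation.Nullary using (yes; no)
  open import Relation.Binary.Definitions using (DecidableEquality)

  open FiniteField Fq using (Vect; 0#)
  open FieldFacts Fq
    using (code; code-injective; code-cong; offset; offset-injectiveˡ; offset-injectiveʳ)
  open Counting

  record HomotheticTuples : Set where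
    field
      x y : Fin (suc k) → Vect d
      x∈E : ∀ i → x i ∈ E
      y∈E : ∀ i → y i ∈ E
      x-injective : Injective _≡_ _≡_ x
      y-injective : Injective _≡_ _≡_ y
      homothetic : ∀ i j c → offset a (y i c) (x i c) ≡ offset a (y j c) (x j c)

  n : ℕ
  n = length E

  point : ℕ → Vect d
  point = at (λ _ → 0#) E

  point-∈ : ∀ {p} → p < n → point p ∈ E
  point-∈ = at-∈ _ E

  point-injective : ∀ {p p'} → p < n → p' < n → point p ≡ point p' → p ≡ p'
  point-injective = at-injective _ E E-unique

  open Occurrences Fin._≟_ (code ∘ point)

  repeated⇒homotheticTuples : ∀ {p} → p < n → k ≤ occurrence p → HomotheticTuples
  repeated⇒homotheticTuples {p} p<n k≤occ = record
    { x = x ; y = x ; x∈E = x∈E ; y∈E = x∈E ; x-injective = x-injective ; y-injective = x-injective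
    ; homothetic = λ i j c → cong (λ w → offset a w w) (x≗x i j c) }
    where
    copies : List ℕ
    copies = positionsBelow (code (point p)) (suc p)

    k<copies : k < length copies
    k<copies = subst (k <_) (sym (length-positionsBelow-suc refl)) (s≤s k≤occ)

    open DistinctMembers (distinct-members k copies (positionsBelow-unique _ (suc p)) k<copies)

    copy : ∀ i → pick i < n × code (point (pick i)) ≡ code (point p)
    copy i = let pick≤p , same = ∈-positionsBelow⁻ (pick-∈ i) in <-≤-trans pick≤p p<n , same

    x : Fin (suc k) → Vect d
    x = point ∘ pick

    x∈E : ∀ i → x i ∈ E
    x∈E i = point-∈ (proj₁ (copy i))

    x-injective : Injective _≡_ _≡_ x
    x-injective eq = pick-injective (point-injective (proj₁ (copy _)) (proj₁ (copy _)) eq)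

    x≗x : ∀ i j c → x i c ≡ x j c
    x≗x i j = code-injective (trans (proj₂ (copy i)) (sym (proj₂ (copy j))))

  module _ (a≢0 : a ≢ 0#) (rare : ∀ {p} → p < n → occurrence p < k) where

    -- For p < n the subtraction does not truncate, as occurrence p < k.
    shift : ℕ → ℕ → ℕ
    shift p s = occurrence s + k ∸ occurrence p

    label : ℕ × ℕ → Fin (q ^ d) × ℕ
    label (p , s) = code (λ c → offset a (point s c) (point p c)) , shift p s

    same-label⇒same-offset : ∀ {p p' s s'} → label (p , s) ≡ label (p' , s') →
      ∀ c → offset a (point s c) (point p c) ≡ offset a (point s' c) (point p' c)
    same-label⇒same-offset eq = code-injective (proj₁ (,-injective eq))

    occurrence≤shifted : ∀ {p} s → p < n → occurrence p ≤ occurrence s + k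
    occurrence≤shifted s p<n = ≤-trans (<⇒≤ (rare p<n)) (m≤n+m k (occurrence s))

    pairs : List (ℕ × ℕ)
    pairs = cartesianProduct (downFrom n) (downFrom n)

    pair< : ∀ {p s} → (p , s) ∈ pairs → p < n × s < n
    pair< ps∈ = map ∈-downFrom⁻ ∈-downFrom⁻ (∈-cartesianProduct⁻ (downFrom n) (downFrom n) ps∈)

    same-label-same-first⇒≡ : ∀ {p s p' s'} → p < n →
      label (p , s) ≡ label (p' , s') → p ≡ p' → (p , s) ≡ (p' , s')
    same-label-same-first⇒≡ {p} {s} {s' = s'} p<n eq refl =
      cong (p ,_) (occurrence-injective same-code same-occurrence)
      where
      same-code : code (point s) ≡ code (point s')
      same-code = code-cong (λ c → offset-injectiveˡ a (same-label⇒same-offset eq c))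
      same-occurrence : occurrence s ≡ occurrence s'
      same-occurrence = +-cancelʳ-≡ k _ _
        (∸-cancelʳ-≡ (occurrence≤shifted s p<n) (occurrence≤shifted s' p<n) (proj₂ (,-injective eq)))

    same-label-same-second⇒≡ : ∀ {p s p' s'} → p < n → p' < n →
      label (p , s) ≡ label (p' , s') → s ≡ s' → (p , s) ≡ (p' , s')
    same-label-same-second⇒≡ {p} {s} {p'} p<n p'<n eq refl =
      cong (_, s) (occurrence-injective same-code same-occurrence)
      where
      same-code : code (point p) ≡ code (point p')
      same-code = code-cong (λ c → offset-injectiveʳ a≢0 (same-label⇒same-offset eq c))
      same-occurrence : occurrence p ≡ occurrence p'
      same-occurrence =
        ∸-cancelˡ-≡ (occurrence≤shifted s p<n) (occurrence≤shifted s p'<n) (proj₂ (,-injective eq))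

    labels : List (Fin (q ^ d) × ℕ)
    labels = cartesianProduct (allFin (q ^ d)) (downFrom (k + k))

    label∈labels : ∀ {ps} → ps ∈ pairs → label ps ∈ labels
    label∈labels {p , s} ps∈ = ∈-cartesianProduct⁺ (∈-allFin _)
      (∈-downFrom⁺ (≤-<-trans (m∸n≤m _ (occurrence p)) (+-monoˡ-< k (rare (proj₂ (pair< ps∈))))))

    _≟ₗ_ : DecidableEquality (Fin (q ^ d) × ℕ)
    _≟ₗ_ = ≡-dec Fin._≟_ ℕ._≟_

    crowded-label : k * (q ^ d * (k + k)) < n * n → ∃[ v ] k < length (fiber _≟ₗ_ label v pairs)
    crowded-label big = pigeonhole _≟ₗ_ label k labels pairs label∈labels
      (subst₂ (λ L P → k * L < P) (sym length-labels) (sym length-pairs) big)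
      where
      length-labels : length labels ≡ q ^ d * (k + k)
      length-labels = trans (length-cartesianProduct (allFin (q ^ d)) (downFrom (k + k)))
        (cong₂ _*_ (length-tabulate {n = q ^ d} id) (length-downFrom (k + k)))
      length-pairs : length pairs ≡ n * n
      length-pairs = trans (length-cartesianProduct (downFrom n) (downFrom n))
        (cong₂ _*_ (length-downFrom n) (length-downFrom n))

    sparse⇒homotheticTuples : k * (q ^ d * (k + k)) < n * n → HomotheticTuples
    sparse⇒homotheticTuples big = record
      { x = point ∘ proj₁ ∘ pick
      ; y = point ∘ proj₂ ∘ pick
      ; x∈E = λ i → point-∈ (proj₁ (pick< i))
      ; y∈E = λ i → point-∈ (proj₂ (pick< i))
      ; x-injective = λ {i} {j} eq → pick-injective
          (same-label-same-first⇒≡ (proj₁ (pick< i)) (same-label i j)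
            (point-injective (proj₁ (pick< i)) (proj₁ (pick< j)) eq))
      ; y-injective = λ {i} {j} eq → pick-injective
          (same-label-same-second⇒≡ (proj₁ (pick< i)) (proj₁ (pick< j)) (same-label i j)
            (point-injective (proj₂ (pick< i)) (proj₂ (pick< j)) eq))
      ; homothetic = λ i j → same-label⇒same-offset (same-label i j)
      }
      where
      v : Fin (q ^ d) × ℕ
      v = proj₁ (crowded-label big)
      pairs-unique : Unique pairs
      pairs-unique = cartesianProduct⁺ (downFrom⁺ n) (downFrom⁺ n)
      open DistinctMembers
        (distinct-members k (fiber _≟ₗ_ label v pairs) (fiber-unique _≟ₗ_ label v pairs-unique)
          (proj₂ (crowded-label big)))
      picked : ∀ i → pick i ∈ pairs × label (pick i) ≡ v
      picked i = ∈-fiber⁻ _≟ₗ_ label (pick-∈ i)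
      pick< : ∀ i → proj₁ (pick i) < n × proj₂ (pick i) < n
      pick< i = pair< (proj₁ (picked i))
      same-label : ∀ i j → label (pick i) ≡ label (pick j)
      same-label i j = trans (proj₂ (picked i)) (sym (proj₂ (picked j)))

  homotheticTuples : a ≢ 0# → k * (q ^ d * (k + k)) < n * n → HomotheticTuples
  homotheticTuples a≢0 big with anyUpTo? (λ p → k ≤? occurrence p) n
  ... | yes (p , p<n , k≤occ) = repeated⇒homotheticTuples p<n k≤occ
  ... | no no-repeat =
    sparse⇒homotheticTuples a≢0 (λ p<n → ≰⇒> (λ k≤occ → no-repeat (_ , p<n , k≤occ))) big

open import Defs
open import Data.Nat using (suc; _*_; _^_; _≥_)
open import Data.Fin using (Fin; _<_)
open import Data.Product using (∃-syntax; Σ-syntax; _×_; _,_)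
open import Data.List using ([]; length)
open import Data.List.Relation.Unary.All using (All)
open import Data.List.Membership.Propositional using (_∈_)
open import Relation.Binary.PropositionalEquality using (_≡_; _≢_)
open import Data.Fin.Properties using (<⇒≢)
import Data.List.Relation.Unary.All as All
open import Relation.Binary.PropositionalEquality using (sym; trans; cong)
open import Function using (_∘_)

theorem1p3 : (q : ℕ) → OddPrimePower q → (Fq : FiniteField q) →
    let open FiniteField Fq renaming (_*_ to _·_) in
    (d k : ℕ) → d ≥ 2 → k ≥ 1 →
    (r : Carrier) → IsNonzeroSquare r →
    (A : List (Fin (suc k) × Fin (suc k))) → A ≢ [] →
    All (λ ij → let (i , j) = ij in i < j) A →
    (E : List (Vect d)) → Unique E →
    length E ^ 2 ≥ 4 * k ^ 2 * q ^ d →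
    Σ[ x ∈ (Fin (suc k) → Vect d) ] Σ[ y ∈ (Fin (suc k) → Vect d) ]
      ((∀ i → x i ∈ E) × (∀ i → y i ∈ E) ×
       All (λ ij → let (i , j) = ij in ‖ y i -ᵥ y j ‖ ≡ r · ‖ x i -ᵥ x j ‖) A ×
       (∀ (i j : Fin (suc k)) → i < j → x i ≢ x j × y i ≢ y j))
theorem1p3 q _ Fq d k _ k≥1 r (r≢0 , a , r≡a·a) A _ _ E E-unique big =
  x , y , x∈E , y∈E , All.tabulate (λ { {i , j} _ → scaled i j }) ,
  λ i j i<j → (<⇒≢ i<j ∘ x-injective) , (<⇒≢ i<j ∘ y-injective)
  where
  open FiniteField Fq renaming (_*_ to _·_)
  open FieldFacts Fq using (‖‖-homothety; q^d-positive; square≢0⇒≢0)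
  a≢0 : a ≢ 0#
  a≢0 = square≢0⇒≢0 (λ a·a≡0 → r≢0 (trans r≡a·a a·a≡0))
  open Homothety Fq E E-unique k a using (homotheticTuples; module HomotheticTuples)
  open HomotheticTuples
    (homotheticTuples a≢0 (Counting.square-bound {n = length E} k≥1 (q^d-positive d) big))
  scaled : ∀ i j → ‖ y i -ᵥ y j ‖ ≡ r · ‖ x i -ᵥ x j ‖
  scaled i j = trans (‖‖-homothety a (homothetic i j)) (cong (_· ‖ x i -ᵥ x j ‖) (sym r≡a·a))
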